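{- If $s=(s_2,\dots,s_n)$ is a down-split sequence, then $s_n=2n-3$.
   Context: Down-split sequences are increasing sequences of positive integers $s=(s_2,\dots,s_n)$ (indexed from $2$) defined recursively: the one-term sequence $(1)$ (with $n=2$) is down-split; for $n>2$, $s$ is down-split if the set $\{2\le k<n: s_k=2k-2\}$ is nonempty and, with $k_s$ its minimum (the splitting index), both $(s_2-1,\dots,s_{k_s}-1)$ and $(s_{k_s+1}-(2k_s-2),\dots,s_n-(2k_s-2))$ are down-split sequences (each re-indexed from $2$). -}

module Defs where

open import Data.Nat using (ℕ; zero; suc; _+_; _*_; _∸_; _<_)
open import Data.Fin using (Fin; toℕ)
open import Data.List using (List; []; _∷_; [_]; length; lookup; take; drop; map)
open import Data.List.Relation.Unary.All using (All)
open import Data.List.Relation.Unary.Linked using (Linked)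
open import Relation.Binary.PropositionalEquality using (_≡_; _≢_)

-- A sequence s = (s_2, …, s_n) is represented as the list [s_2, …, s_n],
-- so n = length s + 1, and the term s_k (2 ≤ k ≤ n) is at list position k - 2.
-- A list position i : Fin (length s) corresponds to index k = toℕ i + 2,
-- and s_k = 2k - 2 reads  lookup s i ≡ 2 * toℕ i + 2.

IncPos : List ℕ → Set
IncPos s = Linked _<_ s × All (0 <_) s
  where open import Data.Product using (_×_)

data DownSplit : List ℕ → Set where
  base  : DownSplit [ 1 ]
  -- n > 2: splitting index k = toℕ i + 2 is the minimal k with 2 ≤ k < n and s_k = 2k - 2
  split : (s : List ℕ)
        → IncPos s
        → (i : Fin (length s))
        → suc (toℕ i) < length s
        → lookup s i ≡ 2 * toℕ i + 2
        → (∀ (j : Fin (length s)) → toℕ j < toℕ i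
             → lookup s j ≢ 2 * toℕ j + 2)
        → DownSplit (map (_∸ 1) (take (suc (toℕ i)) s))
        → DownSplit (map (_∸ (2 * toℕ i + 2)) (drop (suc (toℕ i)) s))
        → DownSplit s

-- Only the right half of a split matters for the last term: it is the last
-- term of the right half shifted back by 2k − 2, and 2k − 2 is twice the
-- length k − 1 of the left half, so the value 2·length − 1 is preserved
-- (with length = n − 1 this is s_n = 2n − 3).
module Submission where

open import Defs
open import Data.Nat using (ℕ; suc; _+_; _*_; _∸_; _<_; s≤s)
open import Data.Nat.Properties
  using (m≤n⇒∃[o]m+o≡n; m∸n≢0⇒n<m; m∸n+n≡m; m+n∸m≡n; 1+n≢0; +-suc; *-suc; *-distribˡ-+; +-comm; <⇒≤)
open import Data.Nat.Tactic.RingSolver using (solve-∀)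
open import Data.List using (List; _∷_; length; last; map; drop)
open import Data.List.Properties using (last-map; length-map; length-drop)
open import Data.Maybe using (Maybe; just; nothing)
import Data.Maybe as Maybe
open import Data.Maybe.Properties using (just-injective)
open import Data.Fin using (toℕ)
open import Data.Product using (_,_)
open import Relation.Binary.PropositionalEquality
  using (_≡_; refl; sym; trans; cong; module ≡-Reasoning)

last-drop : ∀ {A : Set} k (xs : List A) → k < length xs → last (drop k xs) ≡ last xs
last-drop 0       xs           _         = refl
last-drop (suc k) (_ ∷ y ∷ ys) (s≤s k<n) = last-drop k (y ∷ ys) k<n

m∸n≡1+o⇒m≡1+o+n : ∀ {m n o} → m ∸ n ≡ suc o → m ≡ suc o + n
m∸n≡1+o⇒m≡1+o+n {m} {n} eq = trans (sym (m∸n+n≡m (<⇒≤ n<m))) (cong (_+ n) eq)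
  where
  n<m : n < m
  n<m = m∸n≢0⇒n<m (λ m∸n≡0 → 1+n≢0 (trans (sym eq) m∸n≡0))

odd-shift : ∀ {x l} j → suc j < l → x ∸ (2 * j + 2) ≡ 2 * (l ∸ suc j) ∸ 1 → x ≡ 2 * l ∸ 1
odd-shift {x} j j<l eq with m≤n⇒∃[o]m+o≡n j<l
... | o , refl = begin
  x                         ≡⟨ m∸n≡1+o⇒m≡1+o+n (trans eq 2[l∸j]∸1≡1+2o) ⟩
  suc (2 * o) + (2 * j + 2) ≡⟨ cong (_∸ 1) (double-distrib o j) ⟩
  2 * (suc (suc j) + o) ∸ 1 ∎
  where
  open ≡-Reasoning
  2[l∸j]∸1≡1+2o : 2 * (suc (j + o) ∸ j) ∸ 1 ≡ suc (2 * o)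
  2[l∸j]∸1≡1+2o = begin
    2 * (suc (j + o) ∸ j) ∸ 1 ≡⟨ cong (λ r → 2 * (r ∸ j) ∸ 1) (+-suc j o) ⟨
    2 * (j + suc o ∸ j) ∸ 1   ≡⟨ cong (λ r → 2 * r ∸ 1) (m+n∸m≡n j (suc o)) ⟩
    2 * suc o ∸ 1             ≡⟨ cong (_∸ 1) (*-suc 2 o) ⟩
    suc (2 * o)               ∎
  double-distrib : ∀ o j → suc (suc (2 * o) + (2 * j + 2)) ≡ 2 * (suc (suc j) + o)
  double-distrib = solve-∀

last-downSplit : ∀ s → DownSplit s → last s ≡ just (2 * length s ∸ 1)
last-downSplit _ base = refl
last-downSplit s (split _ _ i j<l _ _ _ right) = unshift (last s) shifted
  where
  open ≡-Reasoning
  j = toℕ i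
  shift : ℕ → ℕ
  shift = _∸ (2 * j + 2)
  shifted : Maybe.map shift (last s) ≡ just (2 * (length s ∸ suc j) ∸ 1)
  shifted = begin
    Maybe.map shift (last s)                    ≡⟨ cong (Maybe.map shift) (last-drop (suc j) s j<l) ⟨
    Maybe.map shift (last (drop (suc j) s))     ≡⟨ last-map shift (drop (suc j) s) ⟨
    last (map shift (drop (suc j) s))           ≡⟨ last-downSplit _ right ⟩
    just (2 * length (map shift (drop (suc j) s)) ∸ 1)
      ≡⟨ cong (λ r → just (2 * r ∸ 1)) (trans (length-map shift (drop (suc j) s)) (length-drop (suc j) s)) ⟩
    just (2 * (length s ∸ suc j) ∸ 1)           ∎
  unshift : (m : Maybe ℕ) → Maybe.map shift m ≡ just (2 * (length s ∸ suc j) ∸ 1) → m ≡ just (2 * length s ∸ 1)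
  unshift nothing  ()
  unshift (just x) eq = cong just (odd-shift j j<l (just-injective eq))

lemma6p6 : (n : ℕ) (s : List ℕ) → length s + 1 ≡ n → DownSplit s
             → last s ≡ just (2 * n ∸ 3)
lemma6p6 _ s refl ds = trans (last-downSplit s ds) (cong just (sym 2[m+1]∸3≡2m∸1))
  where
  2[m+1]∸3≡2m∸1 : 2 * (length s + 1) ∸ 3 ≡ 2 * length s ∸ 1
  2[m+1]∸3≡2m∸1 = cong (_∸ 3) (trans (*-distribˡ-+ 2 (length s) 1) (+-comm (2 * length s) 2))
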